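{- Consider the following problem (min-RIPDD with at most one data hand-over per agent). An instance consists of a connected undirected graph $G$ in which every edge $e$ has a positive integer length $w(e)$, two vertices $s\neq t$, a fixed $s$–$t$ path $\mathcal{P}$ in $G$ of total length $W$, and $k\ge 1$ agents located initially at vertices $q_1,\dots,q_k$ of $G$. Following the paper's convention, every edge of length $w(e)$ is regarded as subdivided into $w(e)$ edges of length $1$, so that "points" of $G$ (and of $\mathcal{P}$) are vertices of this subdivided graph, and $d(x,y)$ denotes the shortest-path distance between points $x,y$. A feasible solution assigns to each agent $i$ a walk $p_i$ in (the subdivided) $G$ starting at $q_i$ (possibly of length $0$), such that the union of the walks contains all of $\mathcal{P}$ and each walk $p_i$ contains (carries data along) at most one connected subpath of $\mathcal{P}$; concretely, there are points $s=s^*_1,s^*_2,\dots,s^*_l$ in order along $\mathcal{P}$ and distinct agents $q^*_1,\dots,q^*_l$, where agent $q^*_j$ travels to $s^*_j$ and then carries the data along $\mathcal{P}$ from $s^*_j$ to $s^*_{j+1}$ (with $s^*_{l+1}=t$). The cost of a solution is the maximum length of a walk $p_i$ (the common energy budget needed), and $R^*$ denotes the minimum cost over all feasible solutions. Algorithm Matching: for every integer $\beta$ with $W/k\le\beta\le W$, do the following (Matching$_\beta$). Cut $\mathcal{P}$, starting from $s$, into consecutive pieces, the first of length $W\bmod\beta$ if this is positive and all others of length exactly $\beta$; let $s_1=s,s_2,\dots,s_{m}$ be the starting points of the pieces (so $m=\lceil W/\beta\rceil\le k$) and $b_j$ the length of the piece starting at $s_j$. Form the complete bipartite graph between the agents $\{q_1,\dots,q_k\}$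 and the selection points $\{s_1,\dots,s_m\}$, where the edge $q_is_j$ has weight $d(q_i,s_j)$, and compute a matching $M_\beta$ covering all selection points that minimizes the maximum weight of a matching edge. The agent matched to $s_j$ walks to $s_j$ along a shortest path and then carries the data along the piece starting at $s_j$; the value of Matching$_\beta$ is $\max_j\big(d(q_{\sigma(j)},s_j)+b_j\big)$, where $q_{\sigma(j)}$ is the agent matched to $s_j$. Matching outputs the solution of minimum value among all Matching$_\beta$. Claim: Matching is a $3$-approximation algorithm for this problem, i.e. for every instance it returns a feasible solution whose cost $R$ satisfies $R\le 3R^*$.
   Context: In the data delivery setting, $k$ mobile agents move along edges of the graph, consuming energy equal to the length traversed; all agents have the same initial energy budget, data must be picked up at $s$ and delivered to $t$, and may only be carried along the fixed path $\mathcal{P}$, being handed from agent to agent when they meet. Each agent may receive the data at most once. The min-RIPDD problem asks for the minimum common energy budget for which delivery along $\mathcal{P}$ is possible. -}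

module Defs where

open import Data.Nat using (ℕ; zero; suc; _+_; _*_; _∸_; _≤_; _<_; _⊔_; _⊓_; _≤?_; _/_; _%_; s≤s)
open import Data.Nat.Properties using (m⊓n≤n)
open import Data.Fin using (Fin; toℕ; fromℕ<) renaming (zero to fzero; suc to fsuc; _<_ to _<ᶠ_)
open import Data.List using (List; []; _∷_; _++_; length; map; upTo; filter)
open import Data.Product using (Σ; _×_; ∃)
open import Data.Unit using (⊤)
open import Relation.Binary.PropositionalEquality using (_≡_; _≢_)
open import Function using (_∘_)
open import Function.Definitions using (Injective)

-- Graphs.  Following the paper's convention every edge of length w(e)
-- is subdivided into w(e) unit edges; we work directly with the
-- resulting unit-length graph.

-- A walk starting at x is given by the list of vertices visited after x;
-- its length is the number of (unit) edges traversed.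
IsWalk : {n : ℕ} → (Fin n → Fin n → Set) → Fin n → List (Fin n) → Set
IsWalk Adj x []       = ⊤
IsWalk Adj x (y ∷ ys) = Adj x y × IsWalk Adj y ys

endOf : {n : ℕ} → Fin n → List (Fin n) → Fin n
endOf x []       = x
endOf x (y ∷ ys) = endOf y ys

maxF : (m : ℕ) → (Fin m → ℕ) → ℕ
maxF zero    f = 0
maxF (suc m) f = f fzero ⊔ maxF m (f ∘ fsuc)

record Instance : Set₁ where
  field
    n       : ℕ                       -- points (vertices of the subdivided graph)
    Adj     : Fin n → Fin n → Set
    Adj-sym : ∀ {x y} → Adj x y → Adj y x
    connected : ∀ x y → Σ (List (Fin n)) λ ws → IsWalk Adj x ws × endOf x ws ≡ y
    W       : ℕ
    P       : Fin (suc W) → Fin n     -- 𝒫 = P 0, P 1, …, P W  (s = P 0, t = P W)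
    P-walk  : ∀ (i : Fin W) → Adj (P (Data.Fin.inject₁ i)) (P (fsuc i))
    P-simple : Injective _≡_ _≡_ P
    s≢t     : P fzero ≢ P (Data.Fin.fromℕ W)
    k       : ℕ
    k≥1     : 1 ≤ k
    q       : Fin k → Fin n

  -- the point of 𝒫 at distance i from s (clamped at t for i > W)
  pt : ℕ → Fin n
  pt i = P (fromℕ< (s≤s (m⊓n≤n i W)))

  -- the points of 𝒫 strictly after position a up to position b
  segment : ℕ → ℕ → List (Fin n)
  segment a b = map (λ i → pt (suc a + i)) (upTo (b ∸ a))

  IsDist : Fin n → Fin n → ℕ → Set
  IsDist x y d =
    (Σ (List (Fin n)) λ ws → IsWalk Adj x ws × endOf x ws ≡ y × length ws ≡ d)
    × (∀ ws → IsWalk Adj x ws → endOf x ws ≡ y → d ≤ length ws)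

  -- hand-over structure: l pieces, piece j starts at position pos j of 𝒫
  -- and is carried by agent (agent j)
  record Schedule : Set where
    field
      l     : ℕ
      pos   : Fin l → ℕ
      agent : Fin l → Fin k

  nextPos : {l : ℕ} → (Fin l → ℕ) → Fin l → ℕ
  nextPos {suc zero}    p fzero    = W
  nextPos {suc (suc l)} p fzero    = p (fsuc fzero)
  nextPos {suc (suc l)} p (fsuc j) = nextPos (p ∘ fsuc) j

  ValidSchedule : Schedule → Set
  ValidSchedule sc =
      1 ≤ l
    × (∀ j → toℕ j ≡ 0 → pos j ≡ 0)
    × (∀ i j → i <ᶠ j → pos i < pos j)
    × (∀ j → pos j < W)
    × Injective _≡_ _≡_ agent
    where open Schedule sc

  Walks : Schedule → Set
  Walks sc =
    Σ (Fin k → List (Fin n)) λ walk →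
        (∀ i → IsWalk Adj (q i) (walk i))
      × (∀ j → Σ (List (Fin n)) λ u →
                 IsWalk Adj (q (agent j)) u
               × endOf (q (agent j)) u ≡ pt (pos j)
               × walk (agent j) ≡ u ++ segment (pos j) (nextPos pos j))
    where open Schedule sc

  cost : (sc : Schedule) → Walks sc → ℕ
  cost _ (walk Data.Product., _) = maxF k (λ i → length (walk i))

  Solution : Set
  Solution = Σ Schedule λ sc → ValidSchedule sc × Walks sc

  solCost : Solution → ℕ
  solCost (sc Data.Product., (_ Data.Product., w)) = cost sc w

  numPieces : ℕ → ℕ
  numPieces zero = 0
  numPieces (suc b) with W % suc b
  ... | zero  = W / suc b
  ... | suc _ = suc (W / suc b)

  -- starting position of the j-th piece (j = 0 is s); the first piece has
  -- length W mod β if that is positive, all others have length β.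
  -- (start (numPieces β) = W, so piece j has length start (j+1) ∸ start j.)
  start : ℕ → ℕ → ℕ
  start zero    j = 0
  start (suc b) j with W % suc b
  ... | zero  = j * suc b
  ... | suc r with j
  ...   | zero   = 0
  ...   | suc j' = suc r + j' * suc b

  pieceLen : ℕ → ℕ → ℕ
  pieceLen β j = start β (suc j) ∸ start β j

  validBetas : List ℕ
  validBetas = filter (λ β → W ≤? k * β) (upTo (suc W))

  module _ (dist : Fin n → Fin n → ℕ) where

    bottleneck : (β : ℕ) → (Fin (numPieces β) → Fin k) → ℕ
    bottleneck β σ = maxF (numPieces β) (λ j → dist (q (σ j)) (pt (start β (toℕ j))))

    IsBottleneckMatching : (β : ℕ) → (Fin (numPieces β) → Fin k) → Set
    IsBottleneckMatching β σ =
      Injective _≡_ _≡_ σ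
      × (∀ τ → Injective _≡_ _≡_ τ → bottleneck β σ ≤ bottleneck β τ)

    value : (β : ℕ) → (Fin (numPieces β) → Fin k) → ℕ
    value β σ = maxF (numPieces β)
                  (λ j → dist (q (σ j)) (pt (start β (toℕ j))) + pieceLen β (toℕ j))

    matchingValue : ((β : ℕ) → Fin (numPieces β) → Fin k) → ℕ
    matchingValue M = Data.List.foldr (λ β acc → value β (M β) ⊓ acc) (value W (M W)) validBetas

  matchSchedule : (β : ℕ) → (Fin (numPieces β) → Fin k) → Schedule
  matchSchedule β σ = record { l = numPieces β ; pos = λ j → start β (toℕ j) ; agent = σ }

-- Let R be the cost of a feasible solution and β = min(R, W). At most k agents carry pieces of
-- length at most R, so W ≤ kβ and β is one of the budgets tried. Give the j-th piece of Matching_β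
-- to the agent that carries the last point of that piece in the solution: it reaches its own
-- pick-up point a within R minus what it carries, and s_j lies at most that far beyond a or at
-- most β before a, so d(agent, s_j) ≤ R + β. Two pieces never get the same agent, since their last
-- points are at least β apart and both carried by it, which would force β < R and β < W. Hence
-- the bottleneck matching has weight at most R + β, and Matching_β costs at most R + 2β ≤ 3R.
module Submission where

open import Defs
open import Data.Nat using (ℕ; _*_; _≤_)
open import Data.Fin using (Fin)
open import Data.Product using (Σ; _×_)
open import Data.List.Membership.Propositional using (_∈_)
open import Relation.Binary.PropositionalEquality using (_≡_)

open import Data.Nat using (zero; suc; _+_; _∸_; _<_; _⊓_; z≤n; s≤s; _≤?_; _/_; _%_; pred; s≤s⁻¹; _≤′_; ≤′-refl; ≤′-step)
open import Data.Nat.Properties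
open import Data.Nat.DivMod using (m≡m%n+[m/n]*n; m%n<n)
open import Data.Fin using (toℕ; fromℕ<; inject₁) renaming (zero to fzero; suc to fsuc)
import Data.Fin.Properties as Fin
open import Data.List using (List; []; _∷_; _++_; length; upTo; applyUpTo; foldr)
open import Data.List.Properties using (length-++; map-cong; map-applyUpTo; length-applyUpTo)
open import Data.List.Membership.Propositional.Properties using (∈-filter⁺; ∈-filter⁻; ∈-upTo⁺)
open import Data.List.Relation.Unary.Any using (here; there)
open import Data.Product using (_,_; proj₁; proj₂)
open import Data.Sum using (_⊎_; inj₁; inj₂; [_,_])
open import Data.Empty using (⊥-elim)
open import Data.Unit using (tt)
open import Relation.Nullary using (Dec; yes; no)
open import Relation.Binary using (tri<; tri≈; tri>)
open import Relation.Binary.PropositionalEquality using (refl; sym; trans; cong; cong₂; subst; subst₂; _≢_)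
open import Function using (_∘_)
open import Function.Definitions using (Injective)

endOf-++ : ∀ {n} (x : Fin n) us vs → endOf x (us ++ vs) ≡ endOf (endOf x us) vs
endOf-++ x []       vs = refl
endOf-++ x (u ∷ us) vs = endOf-++ u us vs

module _ {n : ℕ} {Adj : Fin n → Fin n → Set} where

  IsWalk-++ : ∀ x us vs → IsWalk Adj x us → IsWalk Adj (endOf x us) vs → IsWalk Adj x (us ++ vs)
  IsWalk-++ x []       vs _          w = w
  IsWalk-++ x (u ∷ us) vs (a , wus) w = a , IsWalk-++ u us vs wus w

  IsWalk-reverse : (∀ {x y} → Adj x y → Adj y x) → ∀ x us → IsWalk Adj x us →
                   Σ (List (Fin n)) λ vs → IsWalk Adj (endOf x us) vs × endOf (endOf x us) vs ≡ x
                                          × length vs ≡ length us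
  IsWalk-reverse sym-Adj x []       _         = [] , tt , refl , refl
  IsWalk-reverse sym-Adj x (u ∷ us) (a , wus) with IsWalk-reverse sym-Adj u us wus
  ... | vs , wvs , end , len =
    vs ++ x ∷ [] ,
    IsWalk-++ _ vs _ wvs (subst (λ z → IsWalk Adj z (x ∷ [])) (sym end) (sym-Adj a , tt)) ,
    trans (endOf-++ _ vs _) (cong (λ z → endOf z (x ∷ [])) end) ,
    trans (length-++ vs) (trans (+-comm (length vs) 1) (cong suc len))

  IsWalk-applyUpTo : (f : ℕ → Fin n) (d : ℕ) → (∀ i → i < d → Adj (f i) (f (suc i))) →
                     IsWalk Adj (f 0) (applyUpTo (f ∘ suc) d) × endOf (f 0) (applyUpTo (f ∘ suc) d) ≡ f d
  IsWalk-applyUpTo f zero    adj = tt , refl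
  IsWalk-applyUpTo f (suc d) adj with IsWalk-applyUpTo (f ∘ suc) d (λ i i<d → adj (suc i) (s≤s i<d))
  ... | w , end = (adj 0 (s≤s z≤n) , w) , end

≤-maxF : ∀ m (f : Fin m → ℕ) j → f j ≤ maxF m f
≤-maxF (suc m) f fzero    = m≤m⊔n _ _
≤-maxF (suc m) f (fsuc j) = ≤-trans (≤-maxF m (f ∘ fsuc) j) (m≤n⊔m _ _)

maxF-lub : ∀ m (f : Fin m → ℕ) {c} → (∀ j → f j ≤ c) → maxF m f ≤ c
maxF-lub zero    f f≤c = z≤n
maxF-lub (suc m) f f≤c = ⊔-lub (f≤c fzero) (maxF-lub m (f ∘ fsuc) (f≤c ∘ fsuc))

foldr-⊓-≤ : ∀ (f : ℕ → ℕ) c {xs x} → x ∈ xs → foldr (λ y acc → f y ⊓ acc) c xs ≤ f x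
foldr-⊓-≤ f c (here refl) = m⊓n≤m _ _
foldr-⊓-≤ f c (there x∈) = ≤-trans (m⊓n≤n _ _) (foldr-⊓-≤ f c x∈)

foldr-⊓-attained : ∀ (f : ℕ → ℕ) c xs →
                   foldr (λ y acc → f y ⊓ acc) c xs ≡ c
                   ⊎ Σ ℕ λ x → x ∈ xs × f x ≡ foldr (λ y acc → f y ⊓ acc) c xs
foldr-⊓-attained f c []       = inj₁ refl
foldr-⊓-attained f c (x ∷ xs) with ⊓-sel (f x) (foldr (λ y acc → f y ⊓ acc) c xs)
... | inj₁ eq = inj₂ (x , here refl , sym eq)
... | inj₂ eq with foldr-⊓-attained f c xs
...   | inj₁ eq′             = inj₁ (trans eq eq′)
...   | inj₂ (y , y∈ , eq′) = inj₂ (y , there y∈ , trans eq′ (sym eq))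

step-mono-≤ : (f : ℕ → ℕ) → (∀ j → f j ≤ f (suc j)) → ∀ {i j} → i ≤ j → f i ≤ f j
step-mono-≤ f step i≤j = go (≤⇒≤′ i≤j)
  where
  go : ∀ {i j} → i ≤′ j → f i ≤ f j
  go ≤′-refl        = ≤-refl
  go (≤′-step i≤′j) = ≤-trans (go i≤′j) (step _)

module Matching (I : Instance) where
  open Instance I

  W>0 : 0 < W
  W>0 with W ≟ 0
  ... | no W≢0  = n≢0⇒n>0 W≢0
  ... | yes W≡0 = ⊥-elim (s≢t (cong P (sym (Fin.toℕ-injective (trans (Fin.toℕ-fromℕ W) W≡0)))))

  pt-adjacent : ∀ j → j < W → Adj (pt j) (pt (suc j))
  pt-adjacent j j<W = subst₂ Adj (sym (cong P (Fin.toℕ-injective pt-j))) (sym (cong P (Fin.toℕ-injective pt-suc-j)))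
                        (P-walk (fromℕ< j<W))
    where
    pt-j : toℕ (fromℕ< (s≤s (m⊓n≤n j W))) ≡ toℕ (inject₁ (fromℕ< j<W))
    pt-j = trans (Fin.toℕ-fromℕ< _)
             (trans (m≤n⇒m⊓n≡m (<⇒≤ j<W)) (sym (trans (Fin.toℕ-inject₁ _) (Fin.toℕ-fromℕ< j<W))))
    pt-suc-j : toℕ (fromℕ< (s≤s (m⊓n≤n (suc j) W))) ≡ toℕ (fsuc (fromℕ< j<W))
    pt-suc-j = trans (Fin.toℕ-fromℕ< _) (trans (m≤n⇒m⊓n≡m j<W) (sym (cong suc (Fin.toℕ-fromℕ< j<W))))

  segment-applyUpTo : ∀ a x → segment a x ≡ applyUpTo (λ i → pt (a + suc i)) (x ∸ a)
  segment-applyUpTo a x = trans (map-cong (λ i → cong pt (sym (+-suc a i))) (upTo (x ∸ a)))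
                                (map-applyUpTo (λ i → i) (λ i → pt (a + suc i)) (x ∸ a))

  length-segment : ∀ a x → length (segment a x) ≡ x ∸ a
  length-segment a x = trans (cong length (segment-applyUpTo a x)) (length-applyUpTo _ (x ∸ a))

  segment-walk : ∀ a x → a ≤ x → x ≤ W →
                 IsWalk Adj (pt a) (segment a x) × endOf (pt a) (segment a x) ≡ pt x
  segment-walk a x a≤x x≤W rewrite segment-applyUpTo a x
    with IsWalk-applyUpTo (λ i → pt (a + i)) (x ∸ a) adjacent
    where
    adjacent : ∀ i → i < x ∸ a → Adj (pt (a + i)) (pt (a + suc i))
    adjacent i i<x∸a = subst (λ z → Adj (pt (a + i)) (pt z)) (sym (+-suc a i))
      (pt-adjacent (a + i) (<-≤-trans (+-monoʳ-< a i<x∸a) (≤-trans (≤-reflexive (m+[n∸m]≡n a≤x)) x≤W)))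
  ... | w , end rewrite +-identityʳ a = w , trans end (cong pt (m+[n∸m]≡n a≤x))

  nextPos-toℕ : ∀ l (p : ℕ → ℕ) → p l ≡ W → ∀ (j : Fin l) → nextPos (p ∘ toℕ) j ≡ p (suc (toℕ j))
  nextPos-toℕ (suc zero)    p pₗ≡W fzero    = sym pₗ≡W
  nextPos-toℕ (suc (suc l)) p pₗ≡W fzero    = refl
  nextPos-toℕ (suc (suc l)) p pₗ≡W (fsuc j) = nextPos-toℕ (suc l) (p ∘ suc) pₗ≡W j

  nextPos≤W : ∀ {l} (p : Fin l → ℕ) → (∀ j → p j < W) → ∀ j → nextPos p j ≤ W
  nextPos≤W {suc zero}    p p<W fzero    = ≤-refl
  nextPos≤W {suc (suc l)} p p<W fzero    = <⇒≤ (p<W (fsuc fzero))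
  nextPos≤W {suc (suc l)} p p<W (fsuc j) = nextPos≤W (p ∘ fsuc) (p<W ∘ fsuc) j

  piece-containing : ∀ {l} (p : Fin (suc l) → ℕ) x → p fzero ≤ x → x < W →
                     Σ (Fin (suc l)) λ i → p i ≤ x × x < nextPos p i
  piece-containing {zero}  p x p₀≤x x<W = fzero , p₀≤x , x<W
  piece-containing {suc l} p x p₀≤x x<W with p (fsuc fzero) ≤? x
  ... | no p₁≰x = fzero , p₀≤x , ≰⇒> p₁≰x
  ... | yes p₁≤x with piece-containing (p ∘ fsuc) x p₁≤x x<W
  ...   | i , pᵢ≤x , x<next = fsuc i , pᵢ≤x , x<next

  W≤pieces*bound : ∀ {l} (p : Fin (suc l) → ℕ) R → (∀ j → nextPos p j ≤ p j + R) → W ≤ p fzero + suc l * R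
  W≤pieces*bound {zero}  p R step = subst (λ z → W ≤ p fzero + z) (sym (+-identityʳ R)) (step fzero)
  W≤pieces*bound {suc l} p R step = begin
    W                                       ≤⟨ W≤pieces*bound (p ∘ fsuc) R (step ∘ fsuc) ⟩
    p (fsuc fzero) + suc l * R              ≤⟨ +-monoˡ-≤ (suc l * R) (step fzero) ⟩
    p fzero + R + suc l * R                 ≡⟨ +-assoc (p fzero) R (suc l * R) ⟩
    p fzero + suc (suc l) * R               ∎
    where open ≤-Reasoning hiding (start)

  module Pieces (b : ℕ) where

    start-zero : start (suc b) 0 ≡ 0
    start-zero with W % suc b
    ... | zero  = refl
    ... | suc _ = refl

    start-one-pos : 0 < start (suc b) 1
    start-one-pos with W % suc b
    ... | zero  = s≤s z≤n
    ... | suc _ = s≤s z≤n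

    start-one≤β : start (suc b) 1 ≤ suc b
    start-one≤β with W % suc b in eq
    ... | zero  = ≤-reflexive (+-identityʳ (suc b))
    ... | suc r = subst (_≤ suc b) (sym (+-identityʳ (suc r))) (<⇒≤ (subst (_< suc b) eq (m%n<n W (suc b))))

    start-suc-suc : ∀ j → start (suc b) (suc (suc j)) ≡ start (suc b) (suc j) + suc b
    start-suc-suc j with W % suc b
    ... | zero  = +-comm (suc b) (suc j * suc b)
    ... | suc r = trans (cong (suc r +_) (+-comm (suc b) (j * suc b))) (sym (+-assoc (suc r) (j * suc b) (suc b)))

    start-numPieces : start (suc b) (numPieces (suc b)) ≡ W
    start-numPieces with W % suc b in eq
    ... | zero  = sym (trans (m≡m%n+[m/n]*n W (suc b)) (cong (_+ (W / suc b) * suc b) eq))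
    ... | suc _ = sym (trans (m≡m%n+[m/n]*n W (suc b)) (cong (_+ (W / suc b) * suc b) eq))

    start-<-suc : ∀ j → start (suc b) j < start (suc b) (suc j)
    start-<-suc zero    = subst (_< start (suc b) 1) (sym start-zero) start-one-pos
    start-<-suc (suc j) = subst (start (suc b) (suc j) <_) (sym (start-suc-suc j)) (m<m+n _ (s≤s z≤n))

    pieceLen≤β : ∀ j → pieceLen (suc b) j ≤ suc b
    pieceLen≤β zero    rewrite start-zero = start-one≤β
    pieceLen≤β (suc j) rewrite start-suc-suc j = ≤-reflexive (m+n∸m≡n (start (suc b) (suc j)) (suc b))

    start-mono-≤ : ∀ {i j} → i ≤ j → start (suc b) i ≤ start (suc b) j
    start-mono-≤ = step-mono-≤ (start (suc b)) (<⇒≤ ∘ start-<-suc)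

    start<W : ∀ j → j < numPieces (suc b) → start (suc b) j < W
    start<W j j<m = <-≤-trans (start-<-suc j) (subst (start (suc b) (suc j) ≤_) start-numPieces (start-mono-≤ j<m))

    numPieces>0 : 0 < numPieces (suc b)
    numPieces>0 with numPieces (suc b) in eq
    ... | suc _ = s≤s z≤n
    ... | zero  = ⊥-elim (<⇒≢ W>0 (trans (sym start-zero) (trans (cong (start (suc b)) (sym eq)) start-numPieces)))

  open Pieces

  ∈-validBetas : ∀ {β} → β ≤ W → W ≤ k * β → β ∈ validBetas
  ∈-validBetas β≤W W≤kβ = ∈-filter⁺ (λ β → W ≤? k * β) (∈-upTo⁺ (s≤s β≤W)) W≤kβ

  W≤kW : W ≤ k * W
  W≤kW = subst (_≤ k * W) (+-identityʳ W) (*-monoˡ-≤ W k≥1)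

  W∈validBetas : W ∈ validBetas
  W∈validBetas = ∈-validBetas ≤-refl W≤kW

  ⊓W∈validBetas : ∀ R → W ≤ k * R → R ⊓ W ∈ validBetas
  ⊓W∈validBetas R W≤kR = ∈-validBetas (m⊓n≤n R W) (subst (W ≤_) (sym (*-distribˡ-⊓ k R W)) (⊓-glb W≤kR W≤kW))

  validBetas-pos : ∀ {β} → β ∈ validBetas → 0 < β
  validBetas-pos {zero}  β∈ = ⊥-elim (<⇒≱ W>0 (subst (W ≤_) (*-zeroʳ k)
                                 (proj₂ (∈-filter⁻ (λ β → W ≤? k * β) {xs = upTo (suc W)} β∈))))
  validBetas-pos {suc _} β∈ = s≤s z≤n

  module Distances (dist : Fin n → Fin n → ℕ) (isDist : ∀ x y → IsDist x y (dist x y)) where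

    dist≤length : ∀ x y ws → IsWalk Adj x ws → endOf x ws ≡ y → dist x y ≤ length ws
    dist≤length x y = proj₂ (isDist x y)

    dist-triangle : ∀ x y z → dist x z ≤ dist x y + dist y z
    dist-triangle x y z with proj₁ (isDist x y) | proj₁ (isDist y z)
    ... | us , wus , end-us , len-us | vs , wvs , end-vs , len-vs =
      subst (dist x z ≤_) (trans (length-++ us) (cong₂ _+_ len-us len-vs))
        (dist≤length x z (us ++ vs)
          (IsWalk-++ x us vs wus (subst (λ a → IsWalk Adj a vs) (sym end-us) wvs))
          (trans (endOf-++ x us vs) (trans (cong (λ a → endOf a vs) end-us) end-vs)))

    dist-sym-≤ : ∀ x y → dist y x ≤ dist x y
    dist-sym-≤ x y with proj₁ (isDist x y)
    ... | us , wus , end-us , len-us with IsWalk-reverse Adj-sym x us wus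
    ...   | vs , wvs , end-vs , len-vs =
      subst (dist y x ≤_) (trans len-vs len-us)
        (dist≤length y x vs (subst (λ a → IsWalk Adj a vs) end-us wvs)
          (trans (cong (λ a → endOf a vs) (sym end-us)) end-vs))

    dist-along-path : ∀ a x → a ≤ W → x ≤ W → dist (pt a) (pt x) ≤ (x ∸ a) + (a ∸ x)
    dist-along-path a x a≤W x≤W with a ≤? x
    ... | yes a≤x with segment-walk a x a≤x x≤W
    ...   | w , end = ≤-trans (dist≤length _ _ (segment a x) w end)
                        (subst (_≤ (x ∸ a) + (a ∸ x)) (sym (length-segment a x)) (m≤m+n _ _))
    dist-along-path a x a≤W x≤W | no a≰x with segment-walk x a (<⇒≤ (≰⇒> a≰x)) a≤W
    ...   | w , end = ≤-trans (dist-sym-≤ (pt x) (pt a)) (≤-trans (dist≤length _ _ (segment x a) w end)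
                        (subst (_≤ (x ∸ a) + (a ∸ x)) (sym (length-segment x a)) (m≤n+m _ _)))

    value≤bottleneck+β : ∀ b σ → value dist (suc b) σ ≤ bottleneck dist (suc b) σ + suc b
    value≤bottleneck+β b σ = maxF-lub (numPieces (suc b)) _
      (λ j → +-mono-≤ (≤-maxF (numPieces (suc b)) _ j) (pieceLen≤β b (toℕ j)))

    -- τ gives the j-th piece of Matching_β to the solution's carrier of the last point of that piece.
    module Reassignment
        {l : ℕ} (pos : Fin (suc l) → ℕ) (carrier : Fin (suc l) → Fin k) (R b : ℕ)
        (pos₀ : pos fzero ≡ 0) (pos<W : ∀ i → pos i < W) (carrier-injective : Injective _≡_ _≡_ carrier)
        (carrier-cost : ∀ i → dist (q (carrier i)) (pt (pos i)) + (nextPos pos i ∸ pos i) ≤ R)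
        (β-maximal : R ≤ suc b ⊎ W ≤ suc b) where

      last : ℕ → ℕ
      last j = pred (start (suc b) (suc j))

      start-suc≡suc-last : ∀ j → start (suc b) (suc j) ≡ suc (last j)
      start-suc≡suc-last j with start (suc b) (suc j) | start-<-suc b j
      ... | suc _ | _ = refl

      start≤last : ∀ j → start (suc b) j ≤ last j
      start≤last j = <⇒≤pred (start-<-suc b j)

      last<start-suc : ∀ j → last j < start (suc b) (suc j)
      last<start-suc j = ≤-reflexive (sym (start-suc≡suc-last j))

      last<W : ∀ (j : Fin (numPieces (suc b))) → last (toℕ j) < W
      last<W j = <-≤-trans (last<start-suc (toℕ j))
        (subst (start (suc b) (suc (toℕ j)) ≤_) (start-numPieces b) (start-mono-≤ b (Fin.toℕ<n j)))

      last-spread : ∀ {j j′} → j < j′ → last j + suc b ≤ last j′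
      last-spread {j} {j′} j<j′ = s≤s⁻¹ (begin
        suc (last j) + suc b         ≡⟨ cong (_+ suc b) (start-suc≡suc-last j) ⟨
        start (suc b) (suc j) + suc b ≡⟨ start-suc-suc b j ⟨
        start (suc b) (suc (suc j))   ≤⟨ start-mono-≤ b (s≤s j<j′) ⟩
        start (suc b) (suc j′)        ≡⟨ start-suc≡suc-last j′ ⟩
        suc (last j′)                 ∎)
        where open ≤-Reasoning hiding (start)

      carrierOf : Fin (numPieces (suc b)) → Fin (suc l)
      carrierOf j = proj₁ (piece-containing pos (last (toℕ j)) (subst (_≤ last (toℕ j)) (sym pos₀) z≤n) (last<W j))

      carrierOf-contains : ∀ j → pos (carrierOf j) ≤ last (toℕ j) × last (toℕ j) < nextPos pos (carrierOf j)
      carrierOf-contains j = proj₂ (piece-containing pos (last (toℕ j)) (subst (_≤ last (toℕ j)) (sym pos₀) z≤n) (last<W j))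

      τ : Fin (numPieces (suc b)) → Fin k
      τ = carrier ∘ carrierOf

      τ-dist : ∀ j → dist (q (τ j)) (pt (start (suc b) (toℕ j))) ≤ R + suc b
      τ-dist j = begin
        dist (q (carrier i)) (pt x)                          ≤⟨ dist-triangle _ (pt a) _ ⟩
        dist (q (carrier i)) (pt a) + dist (pt a) (pt x)     ≤⟨ +-monoʳ-≤ (dist (q (carrier i)) (pt a)) (dist-along-path a x (<⇒≤ (pos<W i))
                                                                  (<⇒≤ (start<W b (toℕ j) (Fin.toℕ<n j)))) ⟩
        dist (q (carrier i)) (pt a) + ((x ∸ a) + (a ∸ x))    ≤⟨ +-monoʳ-≤ (dist (q (carrier i)) (pt a)) (+-mono-≤ forward backward) ⟩
        dist (q (carrier i)) (pt a) + ((e ∸ a) + suc b)      ≡⟨ +-assoc _ (e ∸ a) (suc b) ⟨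
        dist (q (carrier i)) (pt a) + (e ∸ a) + suc b        ≤⟨ +-monoˡ-≤ (suc b) (carrier-cost i) ⟩
        R + suc b                                            ∎
        where
        open ≤-Reasoning hiding (start)
        i = carrierOf j
        a = pos i
        x = start (suc b) (toℕ j)
        e = nextPos pos i
        forward : x ∸ a ≤ e ∸ a
        forward = ∸-monoˡ-≤ a (<⇒≤ (≤-<-trans (start≤last (toℕ j)) (proj₂ (carrierOf-contains j))))
        backward : a ∸ x ≤ suc b
        backward = ≤-trans (∸-monoˡ-≤ x (≤-trans (proj₁ (carrierOf-contains j)) (<⇒≤ (last<start-suc (toℕ j)))))
                           (pieceLen≤β b (toℕ j))

      shared-carrier⇒β<R : ∀ {j j′ : Fin (numPieces (suc b))} → toℕ j < toℕ j′ → carrierOf j ≡ carrierOf j′ → suc b < R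
      shared-carrier⇒β<R {j} {j′} j<j′ same = +-cancelˡ-< (last (toℕ j)) (suc b) R
        (≤-<-trans (last-spread j<j′) (<-≤-trans (proj₂ (carrierOf-contains j′)) next≤last+R))
        where
        next≤last+R : nextPos pos (carrierOf j′) ≤ last (toℕ j) + R
        next≤last+R = ≤-trans (m≤n+m∸n _ (pos (carrierOf j′)))
          (+-mono-≤ (subst (λ i → pos i ≤ last (toℕ j)) same (proj₁ (carrierOf-contains j)))
                    (≤-trans (m≤n+m _ _) (carrier-cost (carrierOf j′))))

      earlier-piece⇒β<W : ∀ {j j′ : Fin (numPieces (suc b))} → toℕ j < toℕ j′ → suc b < W
      earlier-piece⇒β<W {j} {j′} j<j′ =
        ≤-<-trans (m≤n+m (suc b) (last (toℕ j))) (≤-<-trans (last-spread j<j′) (last<W j′))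

      carrierOf-<-distinct : ∀ {j j′ : Fin (numPieces (suc b))} → toℕ j < toℕ j′ → carrierOf j ≢ carrierOf j′
      carrierOf-<-distinct j<j′ same =
        [ <⇒≱ (shared-carrier⇒β<R j<j′ same) , <⇒≱ (earlier-piece⇒β<W j<j′) ] β-maximal

      τ-injective : Injective _≡_ _≡_ τ
      τ-injective {j} {j′} eq with Fin.<-cmp j j′
      ... | tri< j<j′ _ _ = ⊥-elim (carrierOf-<-distinct j<j′ (carrier-injective eq))
      ... | tri≈ _ j≡j′ _ = j≡j′
      ... | tri> _ _ j′<j = ⊥-elim (carrierOf-<-distinct j′<j (sym (carrier-injective eq)))

    module Realisation (b : ℕ) (σ : Fin (numPieces (suc b)) → Fin k) (σ-injective : Injective _≡_ _≡_ σ) where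

      pos : Fin (numPieces (suc b)) → ℕ
      pos j = start (suc b) (toℕ j)

      valid : ValidSchedule (matchSchedule (suc b) σ)
      valid = numPieces>0 b
            , (λ j j≡0 → subst (λ z → start (suc b) z ≡ 0) (sym j≡0) (start-zero b))
            , (λ i j i<j → <-≤-trans (start-<-suc b (toℕ i)) (start-mono-≤ b i<j))
            , (λ j → start<W b (toℕ j) (Fin.toℕ<n j))
            , σ-injective

      next≡start-suc : ∀ j → nextPos pos j ≡ start (suc b) (suc (toℕ j))
      next≡start-suc = nextPos-toℕ (numPieces (suc b)) (start (suc b)) (start-numPieces b)

      approach : Fin (numPieces (suc b)) → List (Fin n)
      approach j = proj₁ (proj₁ (isDist (q (σ j)) (pt (pos j))))

      approach-walk : ∀ j → IsWalk Adj (q (σ j)) (approach j)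
      approach-walk j = proj₁ (proj₂ (proj₁ (isDist (q (σ j)) (pt (pos j)))))

      approach-end : ∀ j → endOf (q (σ j)) (approach j) ≡ pt (pos j)
      approach-end j = proj₁ (proj₂ (proj₂ (proj₁ (isDist (q (σ j)) (pt (pos j))))))

      approach-length : ∀ j → length (approach j) ≡ dist (q (σ j)) (pt (pos j))
      approach-length j = proj₂ (proj₂ (proj₂ (proj₁ (isDist (q (σ j)) (pt (pos j))))))

      route : Fin (numPieces (suc b)) → List (Fin n)
      route j = approach j ++ segment (pos j) (nextPos pos j)

      route-walk : ∀ j → IsWalk Adj (q (σ j)) (route j)
      route-walk j = IsWalk-++ _ (approach j) _ (approach-walk j)
        (subst (λ z → IsWalk Adj z (segment (pos j) (nextPos pos j))) (sym (approach-end j))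
          (proj₁ (segment-walk (pos j) (nextPos pos j)
                   (subst (pos j ≤_) (sym (next≡start-suc j)) (<⇒≤ (start-<-suc b (toℕ j))))
                   (nextPos≤W pos (λ j → start<W b (toℕ j) (Fin.toℕ<n j)) j))))

      routeCost : Fin (numPieces (suc b)) → ℕ
      routeCost j = dist (q (σ j)) (pt (start (suc b) (toℕ j))) + pieceLen (suc b) (toℕ j)

      length-route : ∀ j → length (route j) ≡ routeCost j
      length-route j = trans (length-++ (approach j))
        (cong₂ _+_ (approach-length j) (trans (length-segment (pos j) (nextPos pos j)) (cong (_∸ pos j) (next≡start-suc j))))

      walkOf : ∀ i → Dec (Σ (Fin (numPieces (suc b))) λ j → σ j ≡ i) → List (Fin n)
      walkOf i (yes (j , _)) = route j
      walkOf i (no _)        = []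

      assigned? : ∀ i → Dec (Σ (Fin (numPieces (suc b))) λ j → σ j ≡ i)
      assigned? i = Fin.any? (λ j → σ j Fin.≟ i)

      walk : Fin k → List (Fin n)
      walk i = walkOf i (assigned? i)

      walkOf-walk : ∀ i d → IsWalk Adj (q i) (walkOf i d)
      walkOf-walk i (yes (j , refl)) = route-walk j
      walkOf-walk i (no _)           = tt

      walkOf-σ : ∀ j d → walkOf (σ j) d ≡ route j
      walkOf-σ j (yes (j′ , eq)) with σ-injective eq
      ... | refl = refl
      walkOf-σ j (no none) = ⊥-elim (none (j , refl))

      walkOf-length : ∀ i d → length (walkOf i d) ≤ maxF (numPieces (suc b)) routeCost
      walkOf-length i (yes (j , _)) = subst (_≤ maxF _ routeCost) (sym (length-route j)) (≤-maxF _ routeCost j)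
      walkOf-length i (no _)        = z≤n

      walks : Walks (matchSchedule (suc b) σ)
      walks = walk , (λ i → walkOf-walk i (assigned? i)) , λ j → approach j , approach-walk j , approach-end j , walkOf-σ j (assigned? (σ j))

      cost≡value : cost (matchSchedule (suc b) σ) walks ≡ value dist (suc b) σ
      cost≡value = ≤-antisym (maxF-lub k _ (λ i → walkOf-length i (assigned? i)))
        (maxF-lub (numPieces (suc b)) routeCost λ j →
          subst (_≤ maxF k (length ∘ walk)) (trans (cong length (walkOf-σ j (assigned? (σ j)))) (length-route j))
                (≤-maxF k (length ∘ walk) (σ j)))

    module Algorithm (M : (β : ℕ) → Fin (numPieces β) → Fin k)
             (isOptimal : ∀ β → β ∈ validBetas → IsBottleneckMatching dist β (M β)) where

      matchingValue≤3R : ∀ {l} (pos : Fin (suc l) → ℕ) (carrier : Fin (suc l) → Fin k) R →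
                         pos fzero ≡ 0 → (∀ i → pos i < W) → Injective _≡_ _≡_ carrier →
                         (∀ i → dist (q (carrier i)) (pt (pos i)) + (nextPos pos i ∸ pos i) ≤ R) →
                         matchingValue dist M ≤ 3 * R
      matchingValue≤3R {l} pos carrier R pos₀ pos<W carrier-injective carrier-cost =
        bound (R ⊓ W) refl (⊓W∈validBetas R W≤kR)
        where
        W≤kR : W ≤ k * R
        W≤kR = begin
          W                  ≤⟨ W≤pieces*bound pos R (λ i → ≤-trans (m≤n+m∸n _ (pos i))
                                  (+-monoʳ-≤ (pos i) (≤-trans (m≤n+m _ _) (carrier-cost i)))) ⟩
          pos fzero + suc l * R ≡⟨ cong (_+ suc l * R) pos₀ ⟩
          suc l * R          ≤⟨ *-monoˡ-≤ R (Fin.injective⇒≤ carrier-injective) ⟩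
          k * R              ∎
          where open ≤-Reasoning hiding (start)

        bound : ∀ β → β ≡ R ⊓ W → β ∈ validBetas → matchingValue dist M ≤ 3 * R
        bound zero    _     β∈ = ⊥-elim (<-irrefl refl (validBetas-pos β∈))
        bound (suc b) β≡R⊓W β∈ = begin
          matchingValue dist M                          ≤⟨ foldr-⊓-≤ (λ β → value dist β (M β)) _ β∈ ⟩
          value dist (suc b) (M (suc b))                ≤⟨ value≤bottleneck+β b (M (suc b)) ⟩
          bottleneck dist (suc b) (M (suc b)) + suc b   ≤⟨ +-monoˡ-≤ (suc b) bottleneck≤R+β ⟩
          R + suc b + suc b                             ≤⟨ +-mono-≤ (+-monoʳ-≤ R β≤R) β≤R ⟩
          R + R + R                                     ≡⟨ trans (+-assoc R R R) (cong (λ z → R + (R + z)) (sym (+-identityʳ R))) ⟩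
          3 * R                                         ∎
          where
          open ≤-Reasoning hiding (start)
          β≤R : suc b ≤ R
          β≤R = subst (_≤ R) (sym β≡R⊓W) (m⊓n≤m R W)
          β-maximal : R ≤ suc b ⊎ W ≤ suc b
          β-maximal with ⊓-sel R W
          ... | inj₁ R⊓W≡R = inj₁ (≤-reflexive (trans (sym R⊓W≡R) (sym β≡R⊓W)))
          ... | inj₂ R⊓W≡W = inj₂ (≤-reflexive (trans (sym R⊓W≡W) (sym β≡R⊓W)))
          open Reassignment pos carrier R b pos₀ pos<W carrier-injective carrier-cost β-maximal
          bottleneck≤R+β : bottleneck dist (suc b) (M (suc b)) ≤ R + suc b
          bottleneck≤R+β = ≤-trans (proj₂ (isOptimal (suc b) β∈) τ τ-injective)
                                   (maxF-lub (numPieces (suc b)) _ τ-dist)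

      matching-3-approx : (S : Solution) → matchingValue dist M ≤ 3 * solCost S
      matching-3-approx (record { l = zero } , (() , _) , _)
      matching-3-approx (record { l = suc l ; pos = pos ; agent = carrier } ,
                         (_ , pos₀ , _ , pos<W , carrier-injective) , (walk , _ , carries)) =
        matchingValue≤3R pos carrier (maxF k (length ∘ walk)) (pos₀ fzero refl) pos<W carrier-injective carrier-cost
        where
        carrier-cost : ∀ i → dist (q (carrier i)) (pt (pos i)) + (nextPos pos i ∸ pos i) ≤ maxF k (length ∘ walk)
        carrier-cost i with carries i
        ... | u , wu , end , walk≡ = ≤-trans (+-monoˡ-≤ _ (dist≤length _ _ u wu end))
          (subst (_≤ maxF k (length ∘ walk))
                 (trans (cong length walk≡) (trans (length-++ u) (cong (length u +_) (length-segment (pos i) _))))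
                 (≤-maxF k (length ∘ walk) (carrier i)))

      realised-by : ∀ β → β ∈ validBetas → value dist β (M β) ≡ matchingValue dist M →
                    Σ ℕ λ β → β ∈ validBetas
                      × value dist β (M β) ≡ matchingValue dist M
                      × ValidSchedule (matchSchedule β (M β))
                      × Σ (Walks (matchSchedule β (M β))) λ ws → cost (matchSchedule β (M β)) ws ≡ matchingValue dist M
      realised-by zero    β∈ _  = ⊥-elim (<-irrefl refl (validBetas-pos β∈))
      realised-by (suc b) β∈ eq = suc b , β∈ , eq , valid , walks , trans cost≡value eq
        where open Realisation b (M (suc b)) (proj₁ (isOptimal (suc b) β∈))

      matching-realised : Σ ℕ λ β → β ∈ validBetas
                            × value dist β (M β) ≡ matchingValue dist M
                            × ValidSchedule (matchSchedule β (M β))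
                            × Σ (Walks (matchSchedule β (M β))) λ ws → cost (matchSchedule β (M β)) ws ≡ matchingValue dist M
      matching-realised with foldr-⊓-attained (λ β → value dist β (M β)) (value dist W (M W)) validBetas
      ... | inj₁ default     = realised-by W W∈validBetas (sym default)
      ... | inj₂ (β , β∈ , eq) = realised-by β β∈ eq

open Instance

theorem2 : (I : Instance) (dist : Fin (n I) → Fin (n I) → ℕ)
           → (∀ x y → IsDist I x y (dist x y))
           → (M : (β : ℕ) → Fin (numPieces I β) → Fin (k I))
           → (∀ β → β ∈ validBetas I → IsBottleneckMatching I dist β (M β))
           → (Σ ℕ λ β → β ∈ validBetas I
                × value I dist β (M β) ≡ matchingValue I dist M
                × ValidSchedule I (matchSchedule I β (M β))
                × Σ (Walks I (matchSchedule I β (M β))) λ ws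
                    → cost I (matchSchedule I β (M β)) ws ≡ matchingValue I dist M)
             × (∀ (S : Solution I) → matchingValue I dist M ≤ 3 * solCost I S)
theorem2 I dist isDist M isOptimal = matching-realised , matching-3-approx
  where open Matching.Distances.Algorithm I dist isDist M isOptimal
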